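{- The isomorphisms from $\mathcal{M}$ to $\mathcal{N}$ are exactly the maps $h_X\cup\bigcup_{z\in H}\psi_z$ where $X\in[\omega]^{<\omega}$ and $\psi_z:\mathcal{M}_z\cong\mathcal{N}_{h_X(z)}$ for each $z\in H$.
   Context: All structures are relational. $\mathcal{H}$ has universe $H=[\omega]^{<\omega}\cup(\omega\times\{0,1\})$ ($[\omega]^{<\omega}$ the finite subsets of $\omega$, identified with characteristic functions) and binary relations $E_i$ ($i<\omega$), with $E_i(X,Y)$ iff $X,Y$ finite sets and $X\triangle Y=\{i\}$, and $D_i$, with $D_i(X,(i,a))$ iff $X$ is a finite set and $X(i)=a$ (nothing else). For $X\in[\omega]^{<\omega}$, $h_X:H\to H$ is $h_X(Y)=X\triangle Y$ on finite sets and $h_X(i,a)=(i,a+X(i)\bmod 2)$. Computably composite structure: given a computable structure $\mathcal{S}$ with universe $S$ and a uniformly computable collection $\{\mathcal{C}_x:x\in S\}$ (uniformly computable languages and atomic diagrams) with pairwise disjoint universes $C_x$ disjoint from $S$, $\mathcal{S}[\{\mathcal{C}_x\}]$ has universe $S\cup\bigcup_xC_x$, a new binary relation $\mu=\{(c,x):c\in C_x\}\cup\{(x,x):x\in S\}$, the relations of $\mathcal{S}$ on $S$, the relations of each $\mathcal{C}_x$ on $C_x$, and nothing else. Fix uniformly computable collections $\{\mathcal{A}_i:i<\omega\}$, $\{\mathcal{B}_i:i<\omega\}$ with $\mathcal{A}_i\cong\mathcal{B}_i$. For $z\in H$ define: $\mathcal{M}_{(i,0)}=\mathcal{N}_{(i,0)}=\{(i,0)\}\times\mathcal{A}_{i+1}$;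 $\mathcal{M}_{(i,1)}=\mathcal{N}_{(i,1)}=\{(i,1)\}\times\mathcal{B}_{i+1}$; for $X\in[\omega]^{<\omega}$, $\mathcal{M}_X=\{X\}\times\mathcal{A}_0$ and $\mathcal{N}_X=\{X\}\times\mathcal{B}_0$ if $|X|$ is even, and $\mathcal{M}_X=\{X\}\times\mathcal{B}_0$ and $\mathcal{N}_X=\{X\}\times\mathcal{A}_0$ if $|X|$ is odd (here $\{z\}\times\mathcal{C}$ denotes the copy of $\mathcal{C}$ with universe $\{z\}\times C$). Let $\mathcal{M}=\mathcal{H}[\{\mathcal{M}_z:z\in H\}]$ and $\mathcal{N}=\mathcal{H}[\{\mathcal{N}_z:z\in H\}]$. -}

module Defs where

open import Data.Nat using (ℕ; zero; suc; _+_)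
open import Data.Bool using (Bool; true; false; not; _xor_; if_then_else_)
open import Data.Sum using (_⊎_; inj₁; inj₂)
open import Data.Product using (Σ; ∃; _×_; _,_)
open import Data.Unit using (⊤; tt)
open import Data.Empty using (⊥)
open import Data.Vec using (Vec; []; _∷_; map)
open import Function.Bundles using (_⇔_)
open import Function.Definitions using (Bijective)
open import Relation.Binary.PropositionalEquality using (_≡_)

-- Finite subsets of ω, in canonical form (so that ≡ is set equality).
-- A nonempty finite set is a list of bits b₀ b₁ … b_k listed from
-- position 0 upward, whose last bit b_k is 1 ('one').

data Pos : Set where
  one  : Pos
  _∷ᵖ_ : Bool → Pos → Pos

infixr 5 _∷ᵖ_

data FinSet : Set where
  ∅   : FinSet
  ⟨_⟩ : Pos → FinSet

memP : Pos → ℕ → Bool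
memP one      zero    = true
memP one      (suc i) = false
memP (b ∷ᵖ p) zero    = b
memP (b ∷ᵖ p) (suc i) = memP p i

mem : FinSet → ℕ → Bool
mem ∅     i = false
mem ⟨ p ⟩ i = memP p i

consF : Bool → FinSet → FinSet
consF false ∅     = ∅
consF true  ∅     = ⟨ one ⟩
consF b     ⟨ p ⟩ = ⟨ b ∷ᵖ p ⟩

_△P_ : Pos → Pos → FinSet
one      △P one      = ∅
one      △P (c ∷ᵖ q) = ⟨ not c ∷ᵖ q ⟩
(b ∷ᵖ p) △P one      = ⟨ not b ∷ᵖ p ⟩
(b ∷ᵖ p) △P (c ∷ᵖ q) = consF (b xor c) (p △P q)

_△_ : FinSet → FinSet → FinSet
∅     △ Y     = Y
⟨ p ⟩ △ ∅     = ⟨ p ⟩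
⟨ p ⟩ △ ⟨ q ⟩ = p △P q

singP : ℕ → Pos
singP zero    = one
singP (suc i) = false ∷ᵖ singP i

sing : ℕ → FinSet
sing i = ⟨ singP i ⟩

cardP : Pos → ℕ
cardP one      = 1
cardP (b ∷ᵖ p) = (if b then 1 else 0) + cardP p

card : FinSet → ℕ
card ∅     = 0
card ⟨ p ⟩ = cardP p

isEven : ℕ → Bool
isEven zero    = true
isEven (suc n) = not (isEven n)

record Signature : Set₁ where
  field
    Sym : Set
    ar  : Sym → ℕ
open Signature public

record Structure (L : Signature) : Set₁ where
  field
    Carrier : Set
    rel     : (s : Sym L) → Vec Carrier (ar L s) → Set
open Structure public

IsIso : {L : Signature} (A : Structure L) (B : Structure L) →
        (Carrier A → Carrier B) → Set
IsIso {L} A B f =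
  Bijective _≡_ _≡_ f ×
  ((s : Sym L) (xs : Vec (Carrier A) (ar L s)) → rel A s xs ⇔ rel B s (map f xs))

Iso : {L : Signature} → Structure L → Structure L → Set
Iso A B = Σ (Carrier A → Carrier B) (IsIso A B)

isoFun : {L : Signature} (A B : Structure L) → Iso A B → Carrier A → Carrier B
isoFun A B (f , _) = f

-- Universe S ⊎ Σ x. C_x (the summand
-- Σ x. C_x plays the role of the disjoint copies {x} × C_x); relations:
-- μ, the relations of S on S, those of the C_x on C_x, nothing else.

compSig : Signature → Signature → Signature
compSig LS LC = record
  { Sym = ⊤ ⊎ (Sym LS ⊎ Sym LC)
  ; ar  = λ { (inj₁ tt) → 2 ; (inj₂ (inj₁ s)) → ar LS s ; (inj₂ (inj₂ s)) → ar LC s } }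

module _ {LS LC : Signature} (S : Structure LS) (C : Carrier S → Structure LC) where

  CompCarrier : Set
  CompCarrier = Carrier S ⊎ Σ (Carrier S) (λ x → Carrier (C x))

  μRel : Vec CompCarrier 2 → Set
  μRel (inj₁ x       ∷ inj₁ y ∷ []) = x ≡ y
  μRel (inj₂ (x , c) ∷ inj₁ y ∷ []) = x ≡ y
  μRel (_            ∷ inj₂ _ ∷ []) = ⊥

  compRel : (s : Sym (compSig LS LC)) → Vec CompCarrier (ar (compSig LS LC) s) → Set
  compRel (inj₁ tt)        xs = μRel xs
  compRel (inj₂ (inj₁ s))  xs =
    Σ (Vec (Carrier S) (ar LS s)) λ ys → (xs ≡ map inj₁ ys) × rel S s ys
  compRel (inj₂ (inj₂ s))  xs =
    Σ (Carrier S) λ x → Σ (Vec (Carrier (C x)) (ar LC s)) λ ys →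
      (xs ≡ map (λ c → inj₂ (x , c)) ys) × rel (C x) s ys

  Composite : Structure (compSig LS LC)
  Composite = record { Carrier = CompCarrier ; rel = compRel }

H : Set
H = FinSet ⊎ (ℕ × Bool)     -- (i , false) is (i,0), (i , true) is (i,1)

-- symbols: inj₁ i = E_i, inj₂ i = D_i
sigH : Signature
sigH = record { Sym = ℕ ⊎ ℕ ; ar = λ _ → 2 }

relH : (s : ℕ ⊎ ℕ) → Vec H 2 → Set
relH (inj₁ i) (inj₁ X ∷ inj₁ Y ∷ [])       = (X △ Y) ≡ sing i
relH (inj₁ i) _                             = ⊥
relH (inj₂ i) (inj₁ X ∷ inj₂ (j , a) ∷ []) = (j ≡ i) × (mem X i ≡ a)
relH (inj₂ i) _                             = ⊥

ℋ : Structure sigH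
ℋ = record { Carrier = H ; rel = relH }

hX : FinSet → H → H
hX X (inj₁ Y)       = inj₁ (X △ Y)
hX X (inj₂ (i , a)) = inj₂ (i , a xor mem X i)

module _ {L : Signature} (A B : ℕ → Structure L) where

  Mcomp : H → Structure L
  Mcomp (inj₁ X)           = if isEven (card X) then A 0 else B 0
  Mcomp (inj₂ (i , false)) = A (suc i)
  Mcomp (inj₂ (i , true))  = B (suc i)

  Ncomp : H → Structure L
  Ncomp (inj₁ X)           = if isEven (card X) then B 0 else A 0
  Ncomp (inj₂ (i , false)) = A (suc i)
  Ncomp (inj₂ (i , true))  = B (suc i)

  𝓜 : Structure (compSig sigH L)
  𝓜 = Composite ℋ Mcomp

  𝓝 : Structure (compSig sigH L)
  𝓝 = Composite ℋ Ncomp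

  glue : (X : FinSet) → ((z : H) → Carrier (Mcomp z) → Carrier (Ncomp (hX X z))) →
         Carrier 𝓜 → Carrier 𝓝
  glue X ψ (inj₁ z)       = inj₁ (hX X z)
  glue X ψ (inj₂ (z , c)) = inj₂ (hX X z , ψ z c)

-- An isomorphism 𝓜 ≅ 𝓝 preserves μ, so it maps the base ℋ (the μ-loops) into itself and the copy
-- over z onto the copy over the image of z.  On ℋ it is then an injective endomorphism, and these
-- are exactly the h_X: for such a G, D_i(Y , (i , Y(i))) forces sets to go to sets and (i , a) to
-- (i , σᵢ a) with G(Y)(i) = σᵢ(Y(i)); injectivity makes σᵢ a bijection of {0 , 1}, and X = G(∅).
-- Conversely h_X is an automorphism of ℋ, and any family of component isomorphisms over it glues
-- to an isomorphism of the composites.  The hypothesis Aᵢ ≅ Bᵢ only serves relations of arity 0.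

module Submission where

open import Defs
open import Data.Nat using (ℕ; zero; suc)
open import Data.Bool using (true; false; not; _xor_)
open import Data.Bool.Properties using (xor-comm; xor-identityʳ; xor-annihilates-not; not-involutive; ¬-not)
open import Data.Sum using (_⊎_; inj₁; inj₂)
open import Data.Sum.Properties using (inj₁-injective; inj₂-injective)
open import Data.Product using (Σ; ∃; _×_; _,_; proj₁; proj₂; uncurry)
open import Data.Product.Properties using (,-injectiveˡ; ,-injectiveʳ)
open import Data.Empty using (⊥-elim)
open import Data.Unit using (tt)
open import Data.Vec using (Vec; []; _∷_; map)
open import Data.Vec.Properties using (∷-injectiveˡ; ∷-injectiveʳ; map-cong; map-∘; map-id)
open import Function.Base using (case_of_)
open import Function.Definitions using (Injective; Surjective)
open import Function.Bundles using (_⇔_; mk⇔; Equivalence)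
open import Function.Construct.Identity using (⇔-id)
open import Function.Construct.Symmetry using (⇔-sym)
open import Function.Construct.Composition using (_⇔-∘_)
open import Relation.Nullary using (¬_)
open import Relation.Binary.PropositionalEquality

open Equivalence using (to; from)

xor-cancelˡ : ∀ x y → x xor (x xor y) ≡ y
xor-cancelˡ false y = refl
xor-cancelˡ true  y = not-involutive y

xor-cancelʳ : ∀ x y → (x xor y) xor y ≡ x
xor-cancelʳ x y = trans (xor-comm (x xor y) y) (trans (cong (y xor_) (xor-comm x y)) (xor-cancelˡ y x))

mem-consF-zero : ∀ b F → mem (consF b F) zero ≡ b
mem-consF-zero false ∅     = refl
mem-consF-zero true  ∅     = refl
mem-consF-zero false ⟨ p ⟩ = refl
mem-consF-zero true  ⟨ p ⟩ = refl

mem-consF-suc : ∀ b F i → mem (consF b F) (suc i) ≡ mem F i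
mem-consF-suc false ∅     i = refl
mem-consF-suc true  ∅     i = refl
mem-consF-suc false ⟨ p ⟩ i = refl
mem-consF-suc true  ⟨ p ⟩ i = refl

memP-△P : ∀ p q i → mem (p △P q) i ≡ memP p i xor memP q i
memP-△P one      one      zero    = refl
memP-△P one      one      (suc i) = refl
memP-△P one      (c ∷ᵖ q) zero    = refl
memP-△P one      (c ∷ᵖ q) (suc i) = refl
memP-△P (b ∷ᵖ p) one      zero    = xor-comm true b
memP-△P (b ∷ᵖ p) one      (suc i) = sym (xor-identityʳ (memP p i))
memP-△P (b ∷ᵖ p) (c ∷ᵖ q) zero    = mem-consF-zero (b xor c) (p △P q)
memP-△P (b ∷ᵖ p) (c ∷ᵖ q) (suc i) = trans (mem-consF-suc (b xor c) (p △P q) i) (memP-△P p q i)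

mem-△ : ∀ X Y i → mem (X △ Y) i ≡ mem X i xor mem Y i
mem-△ ∅     Y     i = refl
mem-△ ⟨ p ⟩ ∅     i = sym (xor-identityʳ (memP p i))
mem-△ ⟨ p ⟩ ⟨ q ⟩ i = memP-△P p q i

mem-sing : ∀ i → mem (sing i) i ≡ true
mem-sing zero    = refl
mem-sing (suc i) = mem-sing i

memP-nonempty : ∀ p → ∃ λ i → memP p i ≡ true
memP-nonempty one      = zero , refl
memP-nonempty (b ∷ᵖ p) = let i , pᵢ = memP-nonempty p in suc i , pᵢ

memP-injective : ∀ p q → (∀ i → memP p i ≡ memP q i) → p ≡ q
memP-injective one      one      _ = refl
memP-injective one      (c ∷ᵖ q) p≗q =
  let i , qᵢ = memP-nonempty q in case trans (p≗q (suc i)) qᵢ of λ ()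
memP-injective (b ∷ᵖ p) one      p≗q =
  let i , pᵢ = memP-nonempty p in case trans (sym (p≗q (suc i))) pᵢ of λ ()
memP-injective (b ∷ᵖ p) (c ∷ᵖ q) p≗q =
  cong₂ _∷ᵖ_ (p≗q zero) (memP-injective p q λ i → p≗q (suc i))

mem-injective : ∀ X Y → (∀ i → mem X i ≡ mem Y i) → X ≡ Y
mem-injective ∅     ∅     _   = refl
mem-injective ∅     ⟨ q ⟩ X≗Y = let i , qᵢ = memP-nonempty q in case trans (X≗Y i) qᵢ of λ ()
mem-injective ⟨ p ⟩ ∅     X≗Y = let i , pᵢ = memP-nonempty p in case trans (sym (X≗Y i)) pᵢ of λ ()
mem-injective ⟨ p ⟩ ⟨ q ⟩ X≗Y = cong ⟨_⟩ (memP-injective p q X≗Y)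

△-involutive : ∀ X Y → X △ (X △ Y) ≡ Y
△-involutive X Y = mem-injective _ _ λ i → begin
  mem (X △ (X △ Y)) i                ≡⟨ mem-△ X (X △ Y) i ⟩
  mem X i xor mem (X △ Y) i          ≡⟨ cong (mem X i xor_) (mem-△ X Y i) ⟩
  mem X i xor (mem X i xor mem Y i)  ≡⟨ xor-cancelˡ (mem X i) (mem Y i) ⟩
  mem Y i                            ∎
  where open ≡-Reasoning

△-cancelˡ : ∀ X Y Z → (X △ Y) △ (X △ Z) ≡ Y △ Z
△-cancelˡ X Y Z = mem-injective _ _ λ i → begin
  mem ((X △ Y) △ (X △ Z)) i                        ≡⟨ mem-△ (X △ Y) (X △ Z) i ⟩
  mem (X △ Y) i xor mem (X △ Z) i                  ≡⟨ cong₂ _xor_ (mem-△ X Y i) (mem-△ X Z i) ⟩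
  (mem X i xor mem Y i) xor (mem X i xor mem Z i)  ≡⟨ xor-cancel (mem X i) (mem Y i) (mem Z i) ⟩
  mem Y i xor mem Z i                              ≡⟨ mem-△ Y Z i ⟨
  mem (Y △ Z) i                                    ∎
  where
  open ≡-Reasoning
  xor-cancel : ∀ x y z → (x xor y) xor (x xor z) ≡ y xor z
  xor-cancel false y z = refl
  xor-cancel true  y z = xor-annihilates-not y z

emptyVec : {A : Set} {n : ℕ} → n ≡ 0 → Vec A n
emptyVec refl = []

map-emptyVec : {A B : Set} {n : ℕ} (f : A → B) (n≡0 : n ≡ 0) → map f (emptyVec n≡0) ≡ emptyVec n≡0
map-emptyVec f refl = refl

module _ {L : Signature} where

  IsHomomorphism : (A B : Structure L) → (Carrier A → Carrier B) → Set
  IsHomomorphism A B f = ∀ s (xs : Vec (Carrier A) (ar L s)) → rel A s xs → rel B s (map f xs)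

  involutive-homomorphism⇒automorphism : (S : Structure L) (g : Carrier S → Carrier S) →
    (∀ x → g (g x) ≡ x) → IsHomomorphism S S g → IsIso S S g
  involutive-homomorphism⇒automorphism S g g-involutive g-hom =
    (g-injective , λ y → g y , λ { refl → g-involutive y }) ,
    λ s xs → mk⇔ (g-hom s xs) λ r → subst (rel S s) (map-g-involutive xs) (g-hom s (map g xs) r)
    where
    g-injective : Injective _≡_ _≡_ g
    g-injective {x} {y} gx≡gy = trans (sym (g-involutive x)) (trans (cong g gx≡gy) (g-involutive y))
    map-g-involutive : ∀ {n} (xs : Vec (Carrier S) n) → map g (map g xs) ≡ xs
    map-g-involutive xs = trans (sym (map-∘ g g xs)) (trans (map-cong g-involutive xs) (map-id xs))

  IsIso-resp-≗ : {A B : Structure L} {f g : Carrier A → Carrier B} →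
    IsIso A B g → (∀ u → f u ≡ g u) → IsIso A B f
  IsIso-resp-≗ {A} {B} {f} ((g-injective , g-surjective) , g-rel) f≗g =
    (f-injective , f-surjective) , f-rel
    where
    f-injective : Injective _≡_ _≡_ f
    f-injective {u} {v} fu≡fv = g-injective (trans (sym (f≗g u)) (trans fu≡fv (f≗g v)))
    f-surjective : Surjective _≡_ _≡_ f
    f-surjective y = let u , gu≡y = g-surjective y in u , λ { refl → trans (f≗g u) (gu≡y refl) }
    f-rel : ∀ s xs → rel A s xs ⇔ rel B s (map f xs)
    f-rel s xs = subst (λ ys → rel A s xs ⇔ rel B s ys) (sym (map-cong f≗g xs)) (g-rel s xs)

  record SameNullary (A B : Structure L) : Set where
    constructor sameNullary
    field
      nullary-⇔ : ∀ s (n≡0 : ar L s ≡ 0) → rel A s (emptyVec n≡0) ⇔ rel B s (emptyVec n≡0)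
  open SameNullary public

  SameNullary-refl : {A : Structure L} → SameNullary A A
  SameNullary-refl = sameNullary λ s n≡0 → ⇔-id _

  SameNullary-sym : {A B : Structure L} → SameNullary A B → SameNullary B A
  SameNullary-sym A≈B = sameNullary λ s n≡0 → ⇔-sym (nullary-⇔ A≈B s n≡0)

  SameNullary-trans : {A B C : Structure L} → SameNullary A B → SameNullary B C → SameNullary A C
  SameNullary-trans A≈B B≈C = sameNullary λ s n≡0 → nullary-⇔ B≈C s n≡0 ⇔-∘ nullary-⇔ A≈B s n≡0

  IsIso⇒SameNullary : {A B : Structure L} {f : Carrier A → Carrier B} → IsIso A B f → SameNullary A B
  IsIso⇒SameNullary {A} {B} {f} (_ , f-rel) = sameNullary λ s n≡0 →
    subst (λ ys → rel A s (emptyVec n≡0) ⇔ rel B s ys) (map-emptyVec f n≡0) (f-rel s (emptyVec n≡0))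

hX-involutive : ∀ X z → hX X (hX X z) ≡ z
hX-involutive X (inj₁ Y)       = cong inj₁ (△-involutive X Y)
hX-involutive X (inj₂ (i , a)) = cong (λ b → inj₂ (i , b)) (xor-cancelʳ a (mem X i))

hX-homomorphism : ∀ X → IsHomomorphism ℋ ℋ (hX X)
hX-homomorphism X (inj₁ i) (inj₁ Y ∷ inj₁ Z ∷ [])       Y△Z≡i         = trans (△-cancelˡ X Y Z) Y△Z≡i
hX-homomorphism X (inj₂ i) (inj₁ Y ∷ inj₂ (i , _) ∷ []) (refl , refl) =
  refl , trans (mem-△ X Y i) (xor-comm (mem X i) (mem Y i))
hX-homomorphism X (inj₁ i) (inj₁ _ ∷ inj₂ _ ∷ []) ()
hX-homomorphism X (inj₁ i) (inj₂ _ ∷ _ ∷ [])      ()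
hX-homomorphism X (inj₂ i) (inj₁ _ ∷ inj₁ _ ∷ []) ()
hX-homomorphism X (inj₂ i) (inj₂ _ ∷ _ ∷ [])      ()

hX-automorphism : ∀ X → IsIso ℋ ℋ (hX X)
hX-automorphism X = involutive-homomorphism⇒automorphism ℋ (hX X) (hX-involutive X) (hX-homomorphism X)

D-inversion : ∀ i u v → relH (inj₂ i) (u ∷ v ∷ []) → ∃ λ Z → u ≡ inj₁ Z × v ≡ inj₂ (i , mem Z i)
D-inversion i (inj₁ Z) (inj₂ (i , _)) (refl , refl) = Z , refl , refl

module _ (G : H → H) (G-injective : Injective _≡_ _≡_ G) (G-hom : IsHomomorphism ℋ ℋ G) where

  private
    G-D : ∀ Y i → ∃ λ Z → G (inj₁ Y) ≡ inj₁ Z × G (inj₂ (i , mem Y i)) ≡ inj₂ (i , mem Z i)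
    G-D Y i = D-inversion i _ _ (G-hom (inj₂ i) (inj₁ Y ∷ inj₂ (i , mem Y i) ∷ []) (refl , refl))

    X : FinSet
    X = proj₁ (G-D ∅ 0)

    G∅≡X : G (inj₁ ∅) ≡ inj₁ X
    G∅≡X = proj₁ (proj₂ (G-D ∅ 0))

    G-point-false : ∀ i → G (inj₂ (i , false)) ≡ inj₂ (i , mem X i)
    G-point-false i =
      let Z , G∅≡Z , G[i,0]≡Z = G-D ∅ i
      in trans G[i,0]≡Z (cong (λ W → inj₂ (i , mem W i)) (inj₁-injective (trans (sym G∅≡Z) G∅≡X)))

    G-point-true : ∀ i → G (inj₂ (i , true)) ≡ inj₂ (i , not (mem X i))
    G-point-true i =
      let Z , _ , G[i,Zi]≡Z = G-D (sing i) i
          G[i,1]≡Z = subst (λ a → G (inj₂ (i , a)) ≡ inj₂ (i , mem Z i)) (mem-sing i) G[i,Zi]≡Z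
          Zi≢Xi : mem Z i ≢ mem X i
          Zi≢Xi Zi≡Xi = case G-injective (trans G[i,1]≡Z
                          (trans (cong (λ b → inj₂ (i , b)) Zi≡Xi) (sym (G-point-false i)))) of λ ()
      in trans G[i,1]≡Z (cong (λ b → inj₂ (i , b)) (¬-not Zi≢Xi))

    G-point : ∀ i a → G (inj₂ (i , a)) ≡ hX X (inj₂ (i , a))
    G-point i false = G-point-false i
    G-point i true  = G-point-true i

    G-set : ∀ Y → G (inj₁ Y) ≡ inj₁ (X △ Y)
    G-set Y = trans GY≡Z (cong inj₁ (mem-injective Z (X △ Y) mem-Z))
      where
      Z : FinSet
      Z = proj₁ (G-D Y 0)
      GY≡Z : G (inj₁ Y) ≡ inj₁ Z
      GY≡Z = proj₁ (proj₂ (G-D Y 0))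
      mem-Z : ∀ i → mem Z i ≡ mem (X △ Y) i
      mem-Z i =
        let Z′ , GY≡Z′ , G[i,Yi]≡Z′ = G-D Y i
        in begin
          mem Z i               ≡⟨ cong (λ W → mem W i) (inj₁-injective (trans (sym GY≡Z) GY≡Z′)) ⟩
          mem Z′ i              ≡⟨ ,-injectiveʳ (inj₂-injective (trans (sym G[i,Yi]≡Z′) (G-point i (mem Y i)))) ⟩
          mem Y i xor mem X i   ≡⟨ xor-comm (mem Y i) (mem X i) ⟩
          mem X i xor mem Y i   ≡⟨ mem-△ X Y i ⟨
          mem (X △ Y) i         ∎
        where open ≡-Reasoning

  injective-endomorphism⇒hX : ∃ λ X → ∀ z → G z ≡ hX X z
  injective-endomorphism⇒hX = X , G≗hX
    where
    G≗hX : ∀ z → G z ≡ hX X z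
    G≗hX (inj₁ Y)       = G-set Y
    G≗hX (inj₂ (i , a)) = G-point i a

module _ {A B : Set} where

  map-injective : {f : A → B} → Injective _≡_ _≡_ f →
    ∀ {n} {xs ys : Vec A n} → map f xs ≡ map f ys → xs ≡ ys
  map-injective f-injective {xs = []}     {[]}     _ = refl
  map-injective f-injective {xs = x ∷ xs} {y ∷ ys} e =
    cong₂ _∷_ (f-injective (∷-injectiveˡ e)) (map-injective f-injective (∷-injectiveʳ e))

  map-commute : {A′ B′ : Set} {g : A → A′} {f : A′ → B} {g′ : A → B′} {f′ : B′ → B} →
    (∀ a → f (g a) ≡ f′ (g′ a)) → ∀ {n} (xs : Vec A n) → map f (map g xs) ≡ map f′ (map g′ xs)
  map-commute square []       = refl
  map-commute square (x ∷ xs) = cong₂ _∷_ (square x) (map-commute square xs)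

module _ {E A : Set} {B : A → Set} where

  fibreIn : (x : A) → B x → E ⊎ Σ A B
  fibreIn x b = inj₂ (x , b)

  fibreIn-injective : {x : A} → Injective _≡_ _≡_ (fibreIn x)
  fibreIn-injective refl = refl

  fibres-injective : {x x′ : A} {n : ℕ} (bs : Vec (B x) (suc n)) (bs′ : Vec (B x′) (suc n)) →
    map (fibreIn x) bs ≡ map (fibreIn x′) bs′ → _≡_ {A = Σ A λ y → Vec (B y) (suc n)} (x , bs) (x′ , bs′)
  fibres-injective (b ∷ bs) (b′ ∷ bs′) e with ∷-injectiveˡ e
  ... | refl = cong (_ ,_) (map-injective fibreIn-injective e)

  -- The relation of a composite for a component symbol s is Lifted (λ x → rel (C x) s).
  Lifted : {n : ℕ} → (∀ x → Vec (B x) n → Set) → Vec (E ⊎ Σ A B) n → Set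
  Lifted R xs = ∃ λ x → ∃ λ bs → xs ≡ map (fibreIn x) bs × R x bs

module _ {LS LC : Signature} {S : Structure LS} {C : Carrier S → Structure LC} where

  μ-loop⇒base : ∀ v → μRel S C (v ∷ v ∷ []) → ∃ λ x → v ≡ inj₁ x
  μ-loop⇒base (inj₁ x) _  = x , refl
  μ-loop⇒base (inj₂ _) ()

  μ-over⇒fibre : ∀ v x → μRel S C (v ∷ inj₁ x ∷ []) → ¬ μRel S C (v ∷ v ∷ []) → ∃ λ c → v ≡ fibreIn x c
  μ-over⇒fibre (inj₁ _)       x _    not-loop = ⊥-elim (not-loop refl)
  μ-over⇒fibre (inj₂ (x , c)) x refl _        = c , refl

module Composites {LS LC : Signature} (S S′ : Structure LS)
                  (C : Carrier S → Structure LC) (D : Carrier S′ → Structure LC) where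

  compositeMap : (h : Carrier S → Carrier S′) → (∀ x → Carrier (C x) → Carrier (D (h x))) →
    CompCarrier S C → CompCarrier S′ D
  compositeMap h ψ (inj₁ x)       = inj₁ (h x)
  compositeMap h ψ (inj₂ (x , c)) = inj₂ (h x , ψ x c)

  module _ {h : Carrier S → Carrier S′} {ψ : ∀ x → Carrier (C x) → Carrier (D (h x))}
           (h-iso : IsIso S S′ h) (ψ-iso : ∀ x → IsIso (C x) (D (h x)) (ψ x)) where

    private
      f : CompCarrier S C → CompCarrier S′ D
      f = compositeMap h ψ
      h-injective : Injective _≡_ _≡_ h
      h-injective = proj₁ (proj₁ h-iso)
      h-surjective : Surjective _≡_ _≡_ h
      h-surjective = proj₂ (proj₁ h-iso)
      h-rel : ∀ s ys → rel S s ys ⇔ rel S′ s (map h ys)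
      h-rel = proj₂ h-iso
      ψ-injective : ∀ x → Injective _≡_ _≡_ (ψ x)
      ψ-injective x = proj₁ (proj₁ (ψ-iso x))
      ψ-surjective : ∀ x → Surjective _≡_ _≡_ (ψ x)
      ψ-surjective x = proj₂ (proj₁ (ψ-iso x))
      ψ-rel : ∀ x s cs → rel (C x) s cs ⇔ rel (D (h x)) s (map (ψ x) cs)
      ψ-rel x = proj₂ (ψ-iso x)

    compositeMap-injective : Injective _≡_ _≡_ f
    compositeMap-injective {inj₁ x}       {inj₁ y}       e = cong inj₁ (h-injective (inj₁-injective e))
    compositeMap-injective {inj₁ _}       {inj₂ _}       ()
    compositeMap-injective {inj₂ _}       {inj₁ _}       ()
    compositeMap-injective {inj₂ (x , c)} {inj₂ (y , d)} e with h-injective (,-injectiveˡ (inj₂-injective e))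
    ... | refl = cong (fibreIn x) (ψ-injective x (fibreIn-injective e))

    compositeMap-surjective : Surjective _≡_ _≡_ f
    compositeMap-surjective (inj₁ w) =
      let x , hx≡w = h-surjective w in inj₁ x , λ { refl → cong inj₁ (hx≡w refl) }
    compositeMap-surjective (inj₂ (w , d)) with h-surjective w
    ... | x , hx≡w with hx≡w refl
    ... | refl = let c , ψc≡d = ψ-surjective x d
                 in inj₂ (x , c) , λ { refl → cong (fibreIn (h x)) (ψc≡d refl) }

    base-preimage : ∀ {n} (xs : Vec (CompCarrier S C) n) ys → map f xs ≡ map inj₁ ys →
      ∃ λ zs → xs ≡ map inj₁ zs × map h zs ≡ ys
    base-preimage []            []       _ = [] , refl , refl
    base-preimage (inj₁ z ∷ xs) (y ∷ ys) e =
      let zs , xs≡zs , hzs≡ys = base-preimage xs ys (∷-injectiveʳ e)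
      in z ∷ zs , cong (inj₁ z ∷_) xs≡zs , cong₂ _∷_ (inj₁-injective (∷-injectiveˡ e)) hzs≡ys
    base-preimage (inj₂ _ ∷ xs) (y ∷ ys) ()

    fibre-preimage : ∀ x {n} (xs : Vec (CompCarrier S C) n) ds → map f xs ≡ map (fibreIn (h x)) ds →
      ∃ λ cs → xs ≡ map (fibreIn x) cs × map (ψ x) cs ≡ ds
    fibre-preimage x []                  []       _ = [] , refl , refl
    fibre-preimage x (inj₁ _ ∷ xs)       (d ∷ ds) ()
    fibre-preimage x (inj₂ (z , c) ∷ xs) (d ∷ ds) e
      with h-injective (,-injectiveˡ (inj₂-injective (∷-injectiveˡ e)))
    ... | refl =
      let cs , xs≡cs , ψcs≡ds = fibre-preimage x xs ds (∷-injectiveʳ e)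
      in c ∷ cs , cong (fibreIn x c ∷_) xs≡cs , cong₂ _∷_ (fibreIn-injective (∷-injectiveˡ e)) ψcs≡ds

    compositeMap-reflects-fibres : ∀ s xs →
      Lifted (λ w → rel (D w) s) (map f xs) → Lifted (λ x → rel (C x) s) xs
    compositeMap-reflects-fibres s xs (w , ds , e , r) with h-surjective w
    ... | x , hx≡w with hx≡w refl
    ... | refl =
      let cs , xs≡cs , ψcs≡ds = fibre-preimage x xs ds e
      in x , cs , xs≡cs , from (ψ-rel x s cs) (subst (rel (D (h x)) s) (sym ψcs≡ds) r)

    compositeMap-rel : ∀ s xs → rel (Composite S C) s xs ⇔ rel (Composite S′ D) s (map f xs)
    compositeMap-rel (inj₁ tt) (inj₁ _       ∷ inj₁ _ ∷ []) = mk⇔ (cong h) h-injective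
    compositeMap-rel (inj₁ tt) (inj₂ (_ , _) ∷ inj₁ _ ∷ []) = mk⇔ (cong h) h-injective
    compositeMap-rel (inj₁ tt) (inj₁ _       ∷ inj₂ _ ∷ []) = ⇔-id _
    compositeMap-rel (inj₁ tt) (inj₂ _       ∷ inj₂ _ ∷ []) = ⇔-id _
    compositeMap-rel (inj₂ (inj₁ s)) xs = mk⇔
      (λ { (ys , refl , r) → map h ys , map-commute (λ _ → refl) ys , to (h-rel s ys) r })
      (λ { (ys , e , r) → let zs , xs≡zs , hzs≡ys = base-preimage xs ys e
                          in zs , xs≡zs , from (h-rel s zs) (subst (rel S′ s) (sym hzs≡ys) r) })
    compositeMap-rel (inj₂ (inj₂ s)) xs = mk⇔
      (λ { (x , cs , refl , r) → h x , map (ψ x) cs , map-commute (λ _ → refl) cs , to (ψ-rel x s cs) r })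
      (compositeMap-reflects-fibres s xs)

    compositeMap-isIso : IsIso (Composite S C) (Composite S′ D) (compositeMap h ψ)
    compositeMap-isIso = (compositeMap-injective , compositeMap-surjective) , compositeMap-rel

  module _ {f : CompCarrier S C → CompCarrier S′ D}
           (f-iso : IsIso (Composite S C) (Composite S′ D) f) where

    private
      f-injective : Injective _≡_ _≡_ f
      f-injective = proj₁ (proj₁ f-iso)
      f-surjective : Surjective _≡_ _≡_ f
      f-surjective = proj₂ (proj₁ f-iso)
      f-rel : ∀ s xs → rel (Composite S C) s xs ⇔ rel (Composite S′ D) s (map f xs)
      f-rel = proj₂ f-iso

    base-injective : {h : Carrier S → Carrier S′} → (∀ x → f (inj₁ x) ≡ inj₁ (h x)) → Injective _≡_ _≡_ h
    base-injective f-base {x} {y} hx≡hy =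
      inj₁-injective (f-injective (trans (f-base x) (trans (cong inj₁ hx≡hy) (sym (f-base y)))))

    base-restriction : Σ (Carrier S → Carrier S′) λ h →
      Injective _≡_ _≡_ h × IsHomomorphism S S′ h × (∀ x → f (inj₁ x) ≡ inj₁ (h x))
    base-restriction = h , base-injective f-base , h-homomorphism , f-base
      where
      base-image : ∀ x → ∃ λ w → f (inj₁ x) ≡ inj₁ w
      base-image x = μ-loop⇒base _ (to (f-rel (inj₁ tt) (inj₁ x ∷ inj₁ x ∷ [])) refl)
      h : Carrier S → Carrier S′
      h x = proj₁ (base-image x)
      f-base : ∀ x → f (inj₁ x) ≡ inj₁ (h x)
      f-base x = proj₂ (base-image x)
      h-homomorphism : IsHomomorphism S S′ h
      h-homomorphism s ys r =
        let ys′ , e , r′ = to (f-rel (inj₂ (inj₁ s)) (map inj₁ ys)) (ys , refl , r)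
            hys≡ys′ = map-injective inj₁-injective (trans (sym (map-commute f-base ys)) e)
        in subst (rel S′ s) (sym hys≡ys′) r′

    module _ {h : Carrier S → Carrier S′} (f-base : ∀ x → f (inj₁ x) ≡ inj₁ (h x))
             (nullary : ∀ x → SameNullary (C x) (D (h x))) where

      private
        fibre-image : ∀ x c → ∃ λ d → f (inj₂ (x , c)) ≡ inj₂ (h x , d)
        fibre-image x c = μ-over⇒fibre _ (h x)
          (subst (λ v → μRel S′ D (f (inj₂ (x , c)) ∷ v ∷ []))
                 (f-base x) (to (f-rel (inj₁ tt) (inj₂ (x , c) ∷ inj₁ x ∷ [])) refl))
          (from (f-rel (inj₁ tt) (inj₂ (x , c) ∷ inj₂ (x , c) ∷ [])))

        ψ : ∀ x → Carrier (C x) → Carrier (D (h x))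
        ψ x c = proj₁ (fibre-image x c)

        f-fibre : ∀ x c → f (inj₂ (x , c)) ≡ inj₂ (h x , ψ x c)
        f-fibre x c = proj₂ (fibre-image x c)

        ψ-injective : ∀ x → Injective _≡_ _≡_ (ψ x)
        ψ-injective x {c} {c′} ψc≡ψc′ = fibreIn-injective
          (f-injective (trans (f-fibre x c) (trans (cong (fibreIn (h x)) ψc≡ψc′) (sym (f-fibre x c′)))))

        ψ-surjective : ∀ x → Surjective _≡_ _≡_ (ψ x)
        ψ-surjective x d with f-surjective (inj₂ (h x , d))
        ... | inj₁ z , fz≡ = case trans (sym (f-base z)) (fz≡ refl) of λ ()
        ... | inj₂ (z , c) , fzc≡
          with base-injective f-base (,-injectiveˡ (inj₂-injective (trans (sym (f-fibre z c)) (fzc≡ refl))))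
        ... | refl = c , λ { refl → fibreIn-injective (trans (sym (f-fibre x c)) (fzc≡ refl)) }

        map-f-fibre : ∀ x {n} (cs : Vec (Carrier (C x)) n) →
          map f (map (fibreIn x) cs) ≡ map (fibreIn (h x)) (map (ψ x) cs)
        map-f-fibre x = map-commute (f-fibre x)

        -- Only arity 0 needs the hypothesis: a nullary relation of the composite merely says that
        -- some component satisfies it, so f says nothing about the individual components there.
        ψ-rel : ∀ n (R : ∀ x → Vec (Carrier (C x)) n → Set) (R′ : ∀ w → Vec (Carrier (D w)) n → Set) →
          (∀ xs → Lifted R xs ⇔ Lifted R′ (map f xs)) →
          ((n≡0 : n ≡ 0) → ∀ x → R x (emptyVec n≡0) ⇔ R′ (h x) (emptyVec n≡0)) →
          ∀ x cs → R x cs ⇔ R′ (h x) (map (ψ x) cs)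
        ψ-rel zero    R R′ _        R≈R′ x [] = R≈R′ refl x
        ψ-rel (suc n) R R′ f-lifted _    x cs = mk⇔
          (λ r → let w , ds , e , r′ = to (f-lifted (map (fibreIn x) cs)) (x , cs , refl , r)
                     ψcs≡ds = fibres-injective (map (ψ x) cs) ds (trans (sym (map-f-fibre x cs)) e)
                 in subst (uncurry R′) (sym ψcs≡ds) r′)
          (λ r′ → let x′ , cs′ , e , r = from (f-lifted (map (fibreIn x) cs))
                                                (h x , map (ψ x) cs , map-f-fibre x cs , r′)
                  in subst (uncurry R) (sym (fibres-injective cs cs′ e)) r)

      iso⇒compositeMap : Σ (∀ x → Carrier (C x) → Carrier (D (h x))) λ ψ →
        (∀ x → IsIso (C x) (D (h x)) (ψ x)) × (∀ u → f u ≡ compositeMap h ψ u)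
      iso⇒compositeMap = ψ , ψ-iso , f≗compositeMap
        where
        ψ-iso : ∀ x → IsIso (C x) (D (h x)) (ψ x)
        ψ-iso x = (ψ-injective x , ψ-surjective x) , λ s →
          ψ-rel (ar LC s) (λ y → rel (C y) s) (λ w → rel (D w) s)
                (f-rel (inj₂ (inj₂ s))) (λ n≡0 y → nullary-⇔ (nullary y) s n≡0) x
        f≗compositeMap : ∀ u → f u ≡ compositeMap h ψ u
        f≗compositeMap (inj₁ x)       = f-base x
        f≗compositeMap (inj₂ (x , c)) = f-fibre x c

module _ {L : Signature} (A B : ℕ → Structure L) (isos : (i : ℕ) → Iso (A i) (B i)) where

  private
    level : H → ℕ
    level (inj₁ _)       = 0
    level (inj₂ (i , _)) = suc i

    B≈A : ∀ i → SameNullary (B i) (A i)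
    B≈A i = SameNullary-sym (IsIso⇒SameNullary (proj₂ (isos i)))

    Mcomp-sameNullary : ∀ z → SameNullary (Mcomp A B z) (A (level z))
    Mcomp-sameNullary (inj₁ Y) with isEven (card Y)
    ... | true  = SameNullary-refl
    ... | false = B≈A 0
    Mcomp-sameNullary (inj₂ (i , false)) = SameNullary-refl
    Mcomp-sameNullary (inj₂ (i , true))  = B≈A (suc i)

    Ncomp-sameNullary : ∀ z → SameNullary (Ncomp A B z) (A (level z))
    Ncomp-sameNullary (inj₁ Y) with isEven (card Y)
    ... | true  = B≈A 0
    ... | false = SameNullary-refl
    Ncomp-sameNullary (inj₂ (i , false)) = SameNullary-refl
    Ncomp-sameNullary (inj₂ (i , true))  = B≈A (suc i)

  components-sameNullary : ∀ X z → SameNullary (Mcomp A B z) (Ncomp A B (hX X z))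
  components-sameNullary X (inj₁ Y) =
    SameNullary-trans (Mcomp-sameNullary (inj₁ Y))
                      (SameNullary-sym (Ncomp-sameNullary (inj₁ (X △ Y))))
  components-sameNullary X (inj₂ (i , a)) =
    SameNullary-trans (Mcomp-sameNullary (inj₂ (i , a)))
                      (SameNullary-sym (Ncomp-sameNullary (inj₂ (i , a xor mem X i))))

glue≗compositeMap : {L : Signature} (A B : ℕ → Structure L) (X : FinSet)
  (ψ : (z : H) → Carrier (Mcomp A B z) → Carrier (Ncomp A B (hX X z))) →
  ∀ u → glue A B X ψ u ≡ Composites.compositeMap ℋ ℋ (Mcomp A B) (Ncomp A B) (hX X) ψ u
glue≗compositeMap A B X ψ (inj₁ _) = refl
glue≗compositeMap A B X ψ (inj₂ _) = refl

proposition3p13 : {L : Signature} (A B : ℕ → Structure L) →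
    ((i : ℕ) → Iso (A i) (B i)) →
    (f : Carrier (𝓜 A B) → Carrier (𝓝 A B)) →
    IsIso (𝓜 A B) (𝓝 A B) f ⇔
      Σ FinSet (λ X → Σ ((z : H) → Iso (Mcomp A B z) (Ncomp A B (hX X z))) (λ ψ →
        (u : Carrier (𝓜 A B)) → f u ≡ glue A B X (λ z → isoFun (Mcomp A B z) (Ncomp A B (hX X z)) (ψ z)) u))
proposition3p13 A B isos f = mk⇔
  (λ f-iso →
    let h , h-injective , h-homomorphism , f-base = base-restriction f-iso
        X , h≗hX = injective-endomorphism⇒hX h h-injective h-homomorphism
        ψ , ψ-iso , f≗ψ = iso⇒compositeMap f-iso (λ x → trans (f-base x) (cong inj₁ (h≗hX x)))
                                            (components-sameNullary A B isos X)
    in X , (λ z → ψ z , ψ-iso z) , λ u → trans (f≗ψ u) (sym (glue≗compositeMap A B X ψ u)))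
  (λ (X , ψ , f≗glue) →
    IsIso-resp-≗ {A = 𝓜 A B} {B = 𝓝 A B}
      (compositeMap-isIso (hX-automorphism X) (λ z → proj₂ (ψ z)))
      (λ u → trans (f≗glue u) (glue≗compositeMap A B X (λ z → proj₁ (ψ z)) u)))
  where open Composites ℋ ℋ (Mcomp A B) (Ncomp A B)
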